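{- Let $\Gamma$ be a finite Abelian group of order $n$ and $m$ a positive integer. Then $\Gamma$ has the $(2m)$-zero-sum-partition property if and only if $2m$ divides $n$, $m\geq 2$, and $\Gamma$ is either of odd order or contains more than one involution.
   Context: Groups are written additively with identity $g_0$; an involution is an element $\iota\neq g_0$ with $2\iota=g_0$. For an integer $k$, a finite Abelian group $\Gamma$ of order $n$ has the $k$-zero-sum-partition property ($k$-ZSP-property) if $k$ divides $n$, $k\geq 2$, and there is a partition of $\Gamma$ into pairwise disjoint subsets $A_1,\ldots,A_t$ with $|A_i|=k$ and $\sum_{a\in A_i}a=g_0$ for $1\le i\le t$. -}

module Defs where

open import Level using (Level)
open import Algebra.Bundles using (AbelianGroup)
open import Data.Nat using (ℕ; _≤_)
open import Data.Nat.Divisibility using (_∣_)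
open import Data.Fin using (Fin)
open import Data.Product using (Σ; ∃; ∃₂; _×_; _,_)
open import Function.Bundles using (Bijection)
open import Relation.Binary.PropositionalEquality as ≡ using (_≡_)
open import Relation.Nullary using (¬_)
import Algebra.Properties.Monoid.Sum as MonoidSum

private
  variable
    c ℓ : Level

module _ (G : AbelianGroup c ℓ) where
  open AbelianGroup G

  private
    module MS = MonoidSum monoid

  HasOrder : ℕ → Set _
  HasOrder n = Bijection (≡.setoid (Fin n)) setoid

  IsInvolution : Carrier → Set ℓ
  IsInvolution ι = ¬ (ι ≈ ε) × (ι ∙ ι ≈ ε)

  MoreThanOneInvolution : Set _
  MoreThanOneInvolution =
    Σ Carrier λ ι₁ → Σ Carrier λ ι₂ →
      IsInvolution ι₁ × IsInvolution ι₂ × ¬ (ι₁ ≈ ι₂)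

  ZSP : (n k : ℕ) → Set _
  ZSP n k =
    k ∣ n × 2 ≤ k ×
    Σ ℕ λ t → Σ (Fin t → Fin k → Carrier) λ A →
      (∀ i j i′ j′ → A i j ≈ A i′ j′ → i ≡ i′ × j ≡ j′) ×
      (∀ g → ∃₂ λ i j → A i j ≈ g) ×
      (∀ i → MS.sum (A i) ≈ ε)

-- Necessity: the blocks partition Γ, so the sum of all elements is g₀.  Pairing every
-- element with its inverse cancels everything outside the 2-torsion subgroup E, so this
-- sum is the sum of E.  As |Γ| is even, so is |E|, and E = {g₀, ι} would have sum ι;
-- hence Γ has two involutions.  Blocks of size 2 are impossible: the block through g₀
-- would be {g₀, g₀}.
-- Sufficiency: Γ ∖ E splits into zero-sum pairs {x, -x}.  Given involutions a ≠ b, the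
-- group E has exponent 2 and contains g₀, a, b, so |E| = 2^j ≥ 4; it splits into pairs
-- {x, a + x}, each with sum a, and two such pairs form a zero-sum quadruple.  A block of
-- size 2m takes ⌊m/2⌋ quadruples and (m mod 2) pairs, topping up with pairs once the
-- quadruples run out.  For odd m every block needs a pair, and there are enough of them:
-- a translate of E lies in Γ ∖ E, unless Γ = E, which is excluded because the odd
-- number m ≥ 3 does not divide 2^j.
module Submission where

open import Defs
open import Level using (Level; 0ℓ; _⊔_)
open import Algebra.Bundles using (AbelianGroup; CommutativeMonoid; RawGroup)
open import Algebra.Core using (Op₁; Op₂)
open import Algebra.Structures using (IsAbelianGroup)
open import Algebra.Morphism.Structures using (IsGroupMonomorphism)
import Algebra.Morphism.GroupMonomorphism as GroupMonomorphism
import Algebra.Properties.CommutativeSemigroup as CommutativeSemigroupProperties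
import Algebra.Properties.Group as GroupProperties
import Algebra.Properties.Monoid.Sum as MonoidSum
open import Data.Nat using (ℕ; zero; suc; _≤_; _+_; _*_; _^_; s≤s; z≤n; _≤?_)
import Data.Nat.Properties as ℕ
open import Data.Nat.Coprimality using (Coprime; coprime-divisor; coprime-+; 1-coprimeTo)
open import Data.Nat.DivMod using (_%_; _/_; m≡m%n+[m/n]*n; m%n<n; m≥n⇒m/n>0)
open import Data.Nat.Divisibility using (_∣_; divides; quotient; ∣1⇒≡1; ∣-trans; n∣m*n; m∣m*n)
open import Data.Nat.Tactic.RingSolver using (solve-∀)
open import Data.Fin using (Fin; zero; suc; cast)
import Data.Fin.Properties as Fin
open import Data.List
  using (List; []; _∷_; _++_; length; concat; map; tabulate; lookup; foldr; filter; take; drop; allFin)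
import Data.List.Properties as List
open import Data.List.Membership.Propositional using (_∈_; _∉_; find)
open import Data.List.Membership.Propositional.Properties
  using (∈-++⁺ˡ; ∈-++⁺ʳ; ∈-++⁻; ∈-∃++; ∈-tabulate⁺; ∈-tabulate⁻; ∈-concat⁺′; ∈-concat⁻′;
         ∈-filter⁺; ∈-filter⁻; ∈-map⁺; ∈-map⁻; ∈-allFin)
open import Data.List.Membership.Propositional.Properties.WithK using (unique∧set⇒bag)
import Data.List.Membership.DecPropositional as DecMembership
open import Data.List.Relation.Unary.Any using (here; there)
open import Data.List.Relation.Unary.All as All using (All; []; _∷_; all?)
import Data.List.Relation.Unary.All.Properties as All
open import Data.List.Relation.Unary.All.Properties.Core using (¬All⇒Any¬)
open import Data.List.Relation.Unary.AllPairs using ([]; _∷_)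
import Data.List.Relation.Unary.AllPairs.Properties as AllPairs
open import Data.List.Relation.Unary.Unique.Propositional using (Unique)
import Data.List.Relation.Unary.Unique.Propositional.Properties as Unique
open import Data.List.Relation.Binary.Subset.Propositional using (_⊆_)
open import Data.List.Relation.Binary.Disjoint.Propositional using (Disjoint)
open import Data.List.Relation.Binary.BagAndSetEquality using (∼bag⇒↭)
open import Data.List.Relation.Binary.Permutation.Propositional
  using (_↭_; ↭-refl; ↭-sym; ↭-trans; ↭-prep; ↭-reflexive; ↭⇒↭ₛ)
import Data.List.Relation.Binary.Permutation.Propositional.Properties as ↭
import Data.List.Relation.Binary.Permutation.Setoid.Properties as ↭ₛ
open import Data.Product using (Σ; ∃; ∃₂; _×_; _,_; proj₁; proj₂)
open import Data.Sum using (_⊎_; inj₁; inj₂)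
open import Data.Empty using (⊥; ⊥-elim)
open import Function.Base using (_∘_)
open import Function.Bundles using (Bijection; Surjection; _⇔_; mk⇔)
open import Relation.Binary.Definitions using (DecidableEquality)
open import Relation.Binary.PropositionalEquality as ≡ using (_≡_; _≢_; refl)
open import Relation.Nullary using (¬_; yes; no; ¬?)
open import Relation.Unary using (Decidable)

module _ {a} {A : Set a} where

  Unique-resp-↭ : ∀ {xs ys : List A} → xs ↭ ys → Unique xs → Unique ys
  Unique-resp-↭ p = ↭ₛ.Unique-resp-↭ (≡.setoid A) (↭⇒↭ₛ p)

  Unique-++⁻ : ∀ xs {ys : List A} → Unique (xs ++ ys) →
               Unique xs × Unique ys × Disjoint xs ys
  Unique-++⁻ []       u          = [] , u , λ ()
  Unique-++⁻ (x ∷ xs) (x∉ ∷ u) with Unique-++⁻ xs u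
  ... | uxs , uys , disjoint =
    All.tabulate (λ y∈ → All.lookup x∉ (∈-++⁺ˡ y∈)) ∷ uxs , uys , disjoint′
    where
      disjoint′ : Disjoint (x ∷ xs) _
      disjoint′ (here refl , y∈) = All.lookup x∉ (∈-++⁺ʳ xs y∈) refl
      disjoint′ (there y∈ , y∈′) = disjoint (y∈ , y∈′)

  ∈⇒↭∷ : ∀ {x : A} {ys} → x ∈ ys → ∃ λ ys′ → ys ↭ x ∷ ys′
  ∈⇒↭∷ x∈ with ys₁ , ys₂ , refl ← ∈-∃++ x∈ = ys₁ ++ ys₂ , ↭.shift _ ys₁ ys₂

  ⊆-resp-removal : ∀ {x : A} {xs ys ys′} → x ∉ xs → xs ⊆ ys → ys ↭ x ∷ ys′ → xs ⊆ ys′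
  ⊆-resp-removal x∉ xs⊆ys p y∈ with ↭.∈-resp-↭ p (xs⊆ys y∈)
  ... | here refl = ⊥-elim (x∉ y∈)
  ... | there y∈ys′ = y∈ys′

  unique∧⊆⇒length≤ : ∀ {xs ys : List A} → Unique xs → xs ⊆ ys → length xs ≤ length ys
  unique∧⊆⇒length≤ {[]}     _ _ = z≤n
  unique∧⊆⇒length≤ {x ∷ xs} u@(_ ∷ uxs) xs⊆ys
    with ys′ , ys↭ ← ∈⇒↭∷ (xs⊆ys (here refl)) =
    ≡.subst (suc (length xs) ≤_) (≡.sym (↭.↭-length ys↭)) (s≤s (unique∧⊆⇒length≤ uxs
      (⊆-resp-removal (Unique.Unique[x∷xs]⇒x∉xs u) (xs⊆ys ∘ there) ys↭)))

  unique∧⊆∧⊇⇒↭ : ∀ {xs ys : List A} → Unique xs → Unique ys →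
                 xs ⊆ ys → ys ⊆ xs → xs ↭ ys
  unique∧⊆∧⊇⇒↭ uxs uys xs⊆ys ys⊆xs =
    ∼bag⇒↭ (unique∧set⇒bag uxs uys (mk⇔ xs⊆ys ys⊆xs))

  length-take-≤ : ∀ n (xs : List A) → n ≤ length xs → length (take n xs) ≡ n
  length-take-≤ n xs n≤ = ≡.trans (List.length-take n xs) (ℕ.m≤n⇒m⊓n≡m n≤)

  length-drop-≤ : ∀ n (xs : List A) → n ≤ length xs → length xs ≡ n + length (drop n xs)
  length-drop-≤ n xs n≤ =
    ≡.sym (≡.trans (≡.cong (n +_) (List.length-drop n xs)) (ℕ.m+[n∸m]≡n n≤))

  pairUp : ∀ {p q} {P : List A → Set p} {Q : List A → Set q} →
           (∀ {u v} → P u → P v → Q (u ++ v)) →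
           ∀ n us → length us ≡ n * 2 → All P us → ∃ λ vs → All Q vs × concat vs ≡ concat us
  pairUp _    zero    []           _   []             = [] , [] , refl
  pairUp join (suc n) (u ∷ v ∷ us) len (pu ∷ pv ∷ ps)
    with vs , qs , eq ← pairUp join n us (ℕ.suc-injective (ℕ.suc-injective len)) ps
    = (u ++ v) ∷ vs , join pu pv ∷ qs ,
      ≡.trans (≡.cong ((u ++ v) ++_) eq) (List.++-assoc u v (concat us))


module _ {a} {A : Set a} (σ : A → A) where

  orbit : A → List A
  orbit x = x ∷ σ x ∷ []

  Closed : List A → Set a
  Closed xs = ∀ {x} → x ∈ xs → σ x ∈ xs

  FixedPointFree : List A → Set a
  FixedPointFree xs = ∀ {x} → x ∈ xs → σ x ≢ x

  length-concat-orbits : ∀ xs → length (concat (map orbit xs)) ≡ length xs * 2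
  length-concat-orbits []       = refl
  length-concat-orbits (x ∷ xs) = ≡.cong (2 +_) (length-concat-orbits xs)

  module _ (σ-involutive : ∀ x → σ (σ x) ≡ x) where

    remove-orbit : ∀ {x xs} → Unique (x ∷ xs) → Closed (x ∷ xs) → FixedPointFree (x ∷ xs) →
                   ∃ λ xs′ → xs ↭ σ x ∷ xs′ × Unique xs′ × Closed xs′ × FixedPointFree xs′
    remove-orbit {x} {xs} u closed free with closed (here refl)
    ... | here σx≡x = ⊥-elim (free (here refl) σx≡x)
    ... | there σx∈xs with xs′ , xs↭ ← ∈⇒↭∷ σx∈xs
      with (_ ∷ x∉) ∷ σx∉ ∷ uxs′ ← Unique-resp-↭ (↭-prep x xs↭) u
      = xs′ , xs↭ , uxs′ , closed′ , free ∘ ∈xs′⇒∈x∷xs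
      where
        ∈xs′⇒∈x∷xs : ∀ {y} → y ∈ xs′ → y ∈ x ∷ xs
        ∈xs′⇒∈x∷xs y∈ = there (↭.∈-resp-↭ (↭-sym xs↭) (there y∈))

        closed′ : Closed xs′
        closed′ {y} y∈ with ↭.∈-resp-↭ (↭-prep x xs↭) (closed (∈xs′⇒∈x∷xs y∈))
        ... | here σy≡x = ⊥-elim (All.lookup σx∉ y∈
                            (≡.trans (≡.cong σ (≡.sym σy≡x)) (σ-involutive y)))
        ... | there (here σy≡σx) = ⊥-elim (All.lookup x∉ y∈
                            (≡.trans (≡.sym (σ-involutive x))
                              (≡.trans (≡.cong σ (≡.sym σy≡σx)) (σ-involutive y))))
        ... | there (there σy∈xs′) = σy∈xs′

    ↭-concat-orbits : ∀ {xs} → Unique xs → Closed xs → FixedPointFree xs →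
                      ∃ λ ys → concat (map orbit ys) ↭ xs
    ↭-concat-orbits {xs} = decompose (length xs) ℕ.≤-refl
      where
        decompose : ∀ n {xs} → length xs ≤ n → Unique xs → Closed xs → FixedPointFree xs →
                    ∃ λ ys → concat (map orbit ys) ↭ xs
        decompose _       {[]}     _         _ _      _    = [] , ↭-refl
        decompose (suc n) {x ∷ xs} (s≤s len) u closed free
          with xs′ , xs↭ , uxs′ , closed′ , free′ ← remove-orbit u closed free
          with ys , p ← decompose n
                          (ℕ.≤-trans (ℕ.n≤1+n _) (≡.subst (_≤ n) (↭.↭-length xs↭) len))
                          uxs′ closed′ free′
          = x ∷ ys , ↭-prep x (↭-trans (↭-prep (σ x) p) (↭-sym xs↭))

module _ {a} {A : Set a} where

  flatten : ∀ {t k} → (Fin t → Fin k → A) → List A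
  flatten B = concat (tabulate (tabulate ∘ B))

  Injective₂ : ∀ {t k} → (Fin t → Fin k → A) → Set a
  Injective₂ B = ∀ i j i′ j′ → B i j ≡ B i′ j′ → i ≡ i′ × j ≡ j′

  ∈-flatten⁺ : ∀ {t k} (B : Fin t → Fin k → A) i j → B i j ∈ flatten B
  ∈-flatten⁺ B i j = ∈-concat⁺′ (∈-tabulate⁺ j) (∈-tabulate⁺ i)

  ∈-flatten⁻ : ∀ {t k} (B : Fin t → Fin k → A) {x} → x ∈ flatten B → ∃₂ λ i j → B i j ≡ x
  ∈-flatten⁻ B x∈ with _ , x∈b , b∈ ← ∈-concat⁻′ _ x∈
    with i , refl ← ∈-tabulate⁻ {f = tabulate ∘ B} b∈
    with j , refl ← ∈-tabulate⁻ {f = B i} x∈b = i , j , refl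

  flatten-unique⁺ : ∀ {t k} (B : Fin t → Fin k → A) → Injective₂ B → Unique (flatten B)
  flatten-unique⁺ B inj = Unique.concat⁺
    (All.tabulate⁺ λ i → Unique.tabulate⁺ λ e → proj₂ (inj _ _ _ _ e))
    (AllPairs.tabulate⁺ λ i≢i′ (x∈ , x∈′) →
      disjoint i≢i′ (∈-tabulate⁻ x∈) (∈-tabulate⁻ x∈′))
    where
      disjoint : ∀ {i i′ x} → i ≢ i′ → ∃ (λ j → x ≡ B i j) → ∃ (λ j′ → x ≡ B i′ j′) →
                 ⊥
      disjoint i≢i′ (j , refl) (j′ , e) = i≢i′ (proj₁ (inj _ _ _ _ e))

  tabulate-injective : ∀ {k} (f : Fin k → A) → Unique (tabulate f) →
                       ∀ {j j′} → f j ≡ f j′ → j ≡ j′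
  tabulate-injective f _         {zero}  {zero}   _ = refl
  tabulate-injective f (f₀∉ ∷ _) {zero}  {suc j′} e =
    ⊥-elim (All.lookup f₀∉ (∈-tabulate⁺ j′) e)
  tabulate-injective f (f₀∉ ∷ _) {suc j} {zero}   e =
    ⊥-elim (All.lookup f₀∉ (∈-tabulate⁺ j) (≡.sym e))
  tabulate-injective f (_ ∷ u)   {suc j} {suc j′} e = ≡.cong suc (tabulate-injective (f ∘ suc) u e)

  flatten-unique⁻ : ∀ {t k} (B : Fin t → Fin k → A) → Unique (flatten B) → Injective₂ B
  flatten-unique⁻ {suc t} B u i j i′ j′ e with Unique-++⁻ (tabulate (B zero)) u
  flatten-unique⁻ B u zero    j zero     j′ e | u₀ , _ , _ = refl , tabulate-injective (B zero) u₀ e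
  flatten-unique⁻ B u zero    j (suc i′) j′ e | _ , _ , disjoint =
    ⊥-elim (disjoint (∈-tabulate⁺ j ,
      ≡.subst (_∈ flatten (B ∘ suc)) (≡.sym e) (∈-flatten⁺ (B ∘ suc) i′ j′)))
  flatten-unique⁻ B u (suc i) j zero     j′ e | _ , _ , disjoint =
    ⊥-elim (disjoint (∈-tabulate⁺ j′ ,
      ≡.subst (_∈ flatten (B ∘ suc)) e (∈-flatten⁺ (B ∘ suc) i j)))
  flatten-unique⁻ B u (suc i) j (suc i′) j′ e | _ , u₊ , _
    with refl , refl ← flatten-unique⁻ (B ∘ suc) u₊ i j i′ j′ e = refl , refl

  fromBlocks : ∀ {k} (bs : List (List A)) → All (λ b → length b ≡ k) bs →
               Fin (length bs) → Fin k → A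
  fromBlocks (b ∷ _)  (len ∷ _)    zero    = lookup b ∘ cast (≡.sym len)
  fromBlocks (_ ∷ bs) (_ ∷ lens) (suc i) = fromBlocks bs lens i

  tabulate-fromBlocks : ∀ {k} (bs : List (List A)) (lens : All (λ b → length b ≡ k) bs) →
                        tabulate (tabulate ∘ fromBlocks bs lens) ≡ bs
  tabulate-fromBlocks []       []          = refl
  tabulate-fromBlocks (b ∷ bs) (refl ∷ lens) =
    ≡.cong₂ _∷_ (≡.trans (List.tabulate-cong (≡.cong (lookup b) ∘ Fin.cast-is-id refl))
                         (List.tabulate-lookup b))
                (tabulate-fromBlocks bs lens)

≤1⇒≤ : ∀ {r n} → r ≤ 1 → (r ≡ 1 → 1 ≤ n) → r ≤ n
≤1⇒≤ z≤n       _ = z≤n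
≤1⇒≤ (s≤s z≤n) h = h refl

4∣2^ : ∀ j → 3 ≤ 2 ^ j → 4 ∣ 2 ^ j
4∣2^ (suc (suc j)) _ = divides (2 ^ j) (lemma (2 ^ j))
  where lemma : ∀ x → 2 * (2 * x) ≡ x * 4
        lemma = solve-∀
4∣2^ zero          (s≤s ())
4∣2^ (suc zero)    (s≤s (s≤s ()))

odd-coprime-2 : ∀ c → Coprime (1 + c * 2) 2
odd-coprime-2 zero    = 1-coprimeTo 2
odd-coprime-2 (suc c) = coprime-+ (odd-coprime-2 c)

coprime-2∧∣2^⇒≡1 : ∀ {d} j → Coprime d 2 → d ∣ 2 ^ j → d ≡ 1
coprime-2∧∣2^⇒≡1 zero    _      d∣1  = ∣1⇒≡1 d∣1
coprime-2∧∣2^⇒≡1 (suc j) coprime d∣2ʲ⁺¹ =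
  coprime-2∧∣2^⇒≡1 j coprime (coprime-divisor coprime d∣2ʲ⁺¹)

2^≢*odd : ∀ j t c → 1 ≤ c → 2 ^ j ≢ t * (2 * (1 + c * 2))
2^≢*odd j t (suc c) _ eq with () ← coprime-2∧∣2^⇒≡1 j (odd-coprime-2 (suc c))
  (∣-trans (n∣m*n 2) (divides t eq))

module Packing {a ℓ} {A : Set a} (Z : List A → Set ℓ)
         (Z-[] : Z []) (Z-++ : ∀ {xs ys} → Z xs → Z ys → Z (xs ++ ys)) where

  open CommutativeSemigroupProperties
    (CommutativeMonoid.commutativeSemigroup (↭.++-commutativeMonoid {A = A}))
    using () renaming (interchange to ++-interchange)

  Pieces : ℕ → List (List A) → Set (a ⊔ ℓ)
  Pieces s = All (λ u → length u ≡ s × Z u)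

  record Partition (k : ℕ) (xs : List A) : Set (a ⊔ ℓ) where
    field
      blocks        : List (List A)
      blocks-pieces : Pieces k blocks
      blocks-↭      : concat blocks ↭ xs

  Partition-resp-↭ : ∀ {k xs ys} → xs ↭ ys → Partition k xs → Partition k ys
  Partition-resp-↭ xs↭ys partition = record
    { blocks = blocks ; blocks-pieces = blocks-pieces ; blocks-↭ = ↭-trans blocks-↭ xs↭ys }
    where open Partition partition

  concat-pieces : ∀ {s} us → Pieces s us → length (concat us) ≡ length us * s × Z (concat us)
  concat-pieces []       []                = refl , Z-[]
  concat-pieces (u ∷ us) ((len , z) ∷ ok) with concat-pieces us ok
  ... | len′ , z′ = ≡.trans (List.length-++ u) (≡.cong₂ _+_ len len′) , Z-++ z z′

  addBlock : ∀ {k} nq np qs ps → Pieces 4 qs → Pieces 2 ps → nq ≤ length qs → np ≤ length ps →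
           nq * 4 + np * 2 ≡ k →
           Partition k (concat (drop nq qs) ++ concat (drop np ps)) →
           Partition k (concat qs ++ concat ps)
  addBlock {k} nq np qs ps qs-ok ps-ok nq≤ np≤ len rest = record
    { blocks        = block ∷ blocks
    ; blocks-pieces = (block-length , Z-++ (proj₂ block-qs) (proj₂ block-ps)) ∷ blocks-pieces
    ; blocks-↭      = ↭-trans (↭.++⁺ˡ block blocks-↭)
                        (↭-trans (++-interchange (concat (take nq qs)) (concat (take np ps)) _ _)
                          (↭-reflexive (≡.cong₂ _++_ (concat-take-drop nq qs) (concat-take-drop np ps))))
    }
    where
      open Partition rest
      block : List A
      block = concat (take nq qs) ++ concat (take np ps)
      block-qs : length (concat (take nq qs)) ≡ length (take nq qs) * 4 × Z (concat (take nq qs))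
      block-qs = concat-pieces (take nq qs) (All.take⁺ nq qs-ok)
      block-ps : length (concat (take np ps)) ≡ length (take np ps) * 2 × Z (concat (take np ps))
      block-ps = concat-pieces (take np ps) (All.take⁺ np ps-ok)
      block-length : length block ≡ k
      block-length = ≡.trans (List.length-++ (concat (take nq qs)))
        (≡.trans (≡.cong₂ _+_ (≡.trans (proj₁ block-qs) (≡.cong (_* 4) (length-take-≤ nq qs nq≤)))
                              (≡.trans (proj₁ block-ps) (≡.cong (_* 2) (length-take-≤ np ps np≤))))
                 len)
      concat-take-drop : ∀ n (us : List (List A)) →
                         concat (take n us) ++ concat (drop n us) ≡ concat us
      concat-take-drop n us = ≡.trans (List.concat-++ (take n us) (drop n us))
                                      (≡.cong concat (List.take++drop≡id n us))

  module _ (c r : ℕ) (1≤c : 1 ≤ c) (r≤1 : r ≤ 1) where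

    private
      k : ℕ
      k = 2 * (r + c * 2)

      1≤m : 1 ≤ r + c * 2
      1≤m = ℕ.≤-trans 1≤c (ℕ.≤-trans (ℕ.m≤m*n c 2) (ℕ.m≤n+m (c * 2) r))

    pack-step : ∀ t qs ps nq np → Pieces 4 qs → Pieces 2 ps →
                length qs * 4 + length ps * 2 ≡ suc t * k →
                nq ≤ length qs → np ≤ length ps → nq * 4 + np * 2 ≡ k →
                (length (drop nq qs) * 4 + length (drop np ps) * 2 ≡ t * k →
                 r ≡ 1 → t ≤ length (drop np ps)) →
                Partition k (concat qs ++ concat ps)

    pack : ∀ t qs ps → Pieces 4 qs → Pieces 2 ps →
           length qs * 4 + length ps * 2 ≡ t * k → (r ≡ 1 → t ≤ length ps) →
           Partition k (concat qs ++ concat ps)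
    pack zero    []      []      _     _     _     _   =
      record { blocks = [] ; blocks-pieces = [] ; blocks-↭ = ↭-refl }
    pack zero    []      (_ ∷ _) _     _     ()    _
    pack zero    (_ ∷ _) _       _     _     ()    _
    pack (suc t) qs      ps      qs-ok ps-ok total odd with c ≤? length qs
    ... | yes c≤ = pack-step t qs ps c r qs-ok ps-ok total c≤ r≤ block-size odd′
      where
        r≤ : r ≤ length ps
        r≤ = ≤1⇒≤ r≤1 λ r≡1 → ℕ.≤-trans (s≤s z≤n) (odd r≡1)
        block-size : c * 4 + r * 2 ≡ k
        block-size = lemma c r
          where lemma : ∀ c r → c * 4 + r * 2 ≡ 2 * (r + c * 2)
                lemma = solve-∀
        odd′ : length (drop c qs) * 4 + length (drop r ps) * 2 ≡ t * k →
               r ≡ 1 → t ≤ length (drop r ps)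
        odd′ _ r≡1 = ℕ.≤-pred (≡.subst (suc t ≤_)
          (≡.trans (length-drop-≤ r ps r≤) (≡.cong (_+ length (drop r ps)) r≡1)) (odd r≡1))
    ... | no c≰ with d , Q+d≡c ← ℕ.m≤n⇒∃[o]m+o≡n (ℕ.<⇒≤ (ℕ.≰⇒> c≰)) =
      pack-step t qs ps (length qs) (r + d * 2) qs-ok ps-ok total ℕ.≤-refl np≤ block-size odd′
      where
        block-size : length qs * 4 + (r + d * 2) * 2 ≡ k
        block-size = ≡.trans (lemma (length qs) d r) (≡.cong (λ c → 2 * (r + c * 2)) Q+d≡c)
          where lemma : ∀ q d r → q * 4 + (r + d * 2) * 2 ≡ 2 * (r + (q + d) * 2)
                lemma = solve-∀
        np≤ : r + d * 2 ≤ length ps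
        np≤ = ℕ.*-cancelʳ-≤ _ _ 2 (ℕ.+-cancelˡ-≤ (length qs * 4) _ _
                (≡.subst₂ _≤_ (≡.sym block-size) (≡.sym total) (ℕ.m≤m+n k (t * k))))
        odd′ : length (drop (length qs) qs) * 4 + length (drop (r + d * 2) ps) * 2 ≡ t * k →
               r ≡ 1 → t ≤ length (drop (r + d * 2) ps)
        odd′ total′ _ rewrite List.length-drop (length qs) qs | ℕ.n∸n≡0 (length qs) =
          ℕ.*-cancelʳ-≤ t _ 2 (≡.subst (t * 2 ≤_) (≡.sym total′)
            (ℕ.*-monoʳ-≤ t (ℕ.*-monoʳ-≤ 2 1≤m)))

    pack-step t qs ps nq np qs-ok ps-ok total nq≤ np≤ block-size odd =
      addBlock nq np qs ps qs-ok ps-ok nq≤ np≤ block-size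
        (pack t (drop nq qs) (drop np ps) (All.drop⁺ nq qs-ok) (All.drop⁺ np ps-ok)
              total′ (odd total′))
      where
        total′ : length (drop nq qs) * 4 + length (drop np ps) * 2 ≡ t * k
        total′ = ℕ.+-cancelˡ-≡ k _ _ (begin
          k + (length (drop nq qs) * 4 + length (drop np ps) * 2)
            ≡⟨ ≡.cong (_+ (length (drop nq qs) * 4 + length (drop np ps) * 2))
                      (≡.sym block-size) ⟩
          (nq * 4 + np * 2) + (length (drop nq qs) * 4 + length (drop np ps) * 2)
            ≡⟨ lemma nq _ np _ ⟩
          (nq + length (drop nq qs)) * 4 + (np + length (drop np ps)) * 2
            ≡⟨ ≡.cong₂ (λ Q P → Q * 4 + P * 2)
                       (length-drop-≤ nq qs nq≤) (length-drop-≤ np ps np≤) ⟨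
          length qs * 4 + length ps * 2
            ≡⟨ total ⟩
          k + t * k ∎)
          where
            open ≡.≡-Reasoning
            lemma : ∀ a b c d → (a * 4 + c * 2) + (b * 4 + d * 2) ≡ (a + b) * 4 + (c + d) * 2
            lemma = solve-∀


module FiniteAbelianGroup {X : Set} (_≟_ : DecidableEquality X)
  {_∙_ : Op₂ X} {ε : X} {_⁻¹ : Op₁ X} (isAbelianGroup : IsAbelianGroup _≡_ _∙_ ε _⁻¹)
  (elements : List X) (elements-unique : Unique elements) (∈-elements : ∀ x → x ∈ elements) where

  open DecMembership _≟_ using (_∈?_)

  abelianGroup : AbelianGroup _ _
  abelianGroup = record { isAbelianGroup = isAbelianGroup }

  open AbelianGroup abelianGroup
    using (assoc; comm; identityˡ; identityʳ; inverseʳ; isCommutativeMonoid; group; commutativeSemigroup)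
  open GroupProperties group using (⁻¹-involutive; inverseʳ-unique; ∙-cancelˡ; ∙-cancelʳ)
  open CommutativeSemigroupProperties commutativeSemigroup using (interchange; x∙yz≈y∙xz)

  sum : List X → X
  sum = foldr _∙_ ε

  sum-++ : ∀ xs ys → sum (xs ++ ys) ≡ sum xs ∙ sum ys
  sum-++ []       ys = ≡.sym (identityˡ (sum ys))
  sum-++ (x ∷ xs) ys = ≡.trans (≡.cong (x ∙_) (sum-++ xs ys)) (≡.sym (assoc x (sum xs) (sum ys)))

  sum-↭ : ∀ {xs ys} → xs ↭ ys → sum xs ≡ sum ys
  sum-↭ p = ↭ₛ.foldr-commMonoid (≡.setoid X) isCommutativeMonoid (↭⇒↭ₛ p)

  ZeroSum : List X → Set
  ZeroSum xs = sum xs ≡ ε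

  ZeroSum-++ : ∀ {xs ys} → ZeroSum xs → ZeroSum ys → ZeroSum (xs ++ ys)
  ZeroSum-++ {xs} {ys} zs zs′ = ≡.trans (sum-++ xs ys) (≡.trans (≡.cong₂ _∙_ zs zs′) (identityˡ ε))

  ZeroSum-concat : ∀ {bs} → All ZeroSum bs → ZeroSum (concat bs)
  ZeroSum-concat []       = refl
  ZeroSum-concat {b ∷ bs} (z ∷ zs) = ZeroSum-++ {b} {concat bs} z (ZeroSum-concat zs)

  open Packing ZeroSum refl (λ {xs} {ys} → ZeroSum-++ {xs} {ys})

  TwoTorsion : X → Set
  TwoTorsion x = x ∙ x ≡ ε

  twoTorsion? : Decidable TwoTorsion
  twoTorsion? x = (x ∙ x) ≟ ε

  TwoTorsion-∙ : ∀ {x y} → TwoTorsion x → TwoTorsion y → TwoTorsion (x ∙ y)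
  TwoTorsion-∙ {x} {y} xx yy =
    ≡.trans (interchange x y x y) (≡.trans (≡.cong₂ _∙_ xx yy) (identityˡ ε))

  ⁻¹≡⇒TwoTorsion : ∀ {x} → x ⁻¹ ≡ x → TwoTorsion x
  ⁻¹≡⇒TwoTorsion {x} x⁻¹≡x = ≡.trans (≡.cong (x ∙_) (≡.sym x⁻¹≡x)) (inverseʳ x)

  TwoTorsion⇒⁻¹≡ : ∀ {x} → TwoTorsion x → x ⁻¹ ≡ x
  TwoTorsion⇒⁻¹≡ {x} xx = ≡.sym (inverseʳ-unique x x xx)

  torsion nonTorsion : List X
  torsion    = filter twoTorsion? elements
  nonTorsion = filter (¬? ∘ twoTorsion?) elements

  torsion-unique : Unique torsion
  torsion-unique = Unique.filter⁺ twoTorsion? elements-unique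

  ∈-torsion⁺ : ∀ {x} → TwoTorsion x → x ∈ torsion
  ∈-torsion⁺ {x} = ∈-filter⁺ twoTorsion? (∈-elements x)

  ∈-torsion⁻ : ∀ {x} → x ∈ torsion → TwoTorsion x
  ∈-torsion⁻ = proj₂ ∘ ∈-filter⁻ twoTorsion? {xs = elements}

  ∈-nonTorsion⁺ : ∀ {x} → ¬ TwoTorsion x → x ∈ nonTorsion
  ∈-nonTorsion⁺ {x} = ∈-filter⁺ (¬? ∘ twoTorsion?) (∈-elements x)

  ∈-nonTorsion⁻ : ∀ {x} → x ∈ nonTorsion → ¬ TwoTorsion x
  ∈-nonTorsion⁻ = proj₂ ∘ ∈-filter⁻ (¬? ∘ twoTorsion?) {xs = elements}

  torsion++nonTorsion↭elements : torsion ++ nonTorsion ↭ elements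
  torsion++nonTorsion↭elements = unique∧⊆∧⊇⇒↭
    (Unique.++⁺ torsion-unique (Unique.filter⁺ (¬? ∘ twoTorsion?) elements-unique)
                λ (x∈T , x∈N) → ∈-nonTorsion⁻ x∈N (∈-torsion⁻ x∈T))
    elements-unique (λ {x} _ → ∈-elements x) split
    where
      split : elements ⊆ torsion ++ nonTorsion
      split {x} _ with twoTorsion? x
      ... | yes xx = ∈-++⁺ˡ (∈-torsion⁺ xx)
      ... | no ¬xx = ∈-++⁺ʳ torsion (∈-nonTorsion⁺ ¬xx)

  inverseOrbits : ∃ λ ys → concat (map (orbit _⁻¹) ys) ↭ nonTorsion
  inverseOrbits = ↭-concat-orbits _⁻¹ ⁻¹-involutive
    (Unique.filter⁺ (¬? ∘ twoTorsion?) elements-unique)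
    (λ {x} x∈ → ∈-nonTorsion⁺ λ xx → ∈-nonTorsion⁻ x∈
      (⁻¹≡⇒TwoTorsion (≡.trans (≡.sym (TwoTorsion⇒⁻¹≡ xx)) (⁻¹-involutive x))))
    (λ x∈ x⁻¹≡x → ∈-nonTorsion⁻ x∈ (⁻¹≡⇒TwoTorsion x⁻¹≡x))

  inversePairs : List (List X)
  inversePairs = map (orbit _⁻¹) (proj₁ inverseOrbits)

  inversePairs-ok : Pieces 2 inversePairs
  inversePairs-ok = All.map⁺ (All.universal (λ x → refl , x∙[x⁻¹∙ε]≡ε x) (proj₁ inverseOrbits))
    where
      x∙[x⁻¹∙ε]≡ε : ∀ x → x ∙ ((x ⁻¹) ∙ ε) ≡ ε
      x∙[x⁻¹∙ε]≡ε x = ≡.trans (≡.cong (x ∙_) (identityʳ (x ⁻¹))) (inverseʳ x)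

  sum-nonTorsion : sum nonTorsion ≡ ε
  sum-nonTorsion = ≡.trans (≡.sym (sum-↭ (proj₂ inverseOrbits)))
                           (ZeroSum-concat (All.map proj₂ inversePairs-ok))

  length-nonTorsion : length nonTorsion ≡ length inversePairs * 2
  length-nonTorsion = ≡.trans (≡.sym (↭.↭-length (proj₂ inverseOrbits)))
    (≡.trans (length-concat-orbits _⁻¹ (proj₁ inverseOrbits))
             (≡.cong (_* 2) (≡.sym (List.length-map (orbit _⁻¹) (proj₁ inverseOrbits)))))

  sum-elements≡sum-torsion : sum elements ≡ sum torsion
  sum-elements≡sum-torsion = begin
    sum elements                      ≡⟨ sum-↭ torsion++nonTorsion↭elements ⟨
    sum (torsion ++ nonTorsion)       ≡⟨ sum-++ torsion nonTorsion ⟩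
    sum torsion ∙ sum nonTorsion      ≡⟨ ≡.cong (sum torsion ∙_) sum-nonTorsion ⟩
    sum torsion ∙ ε                   ≡⟨ identityʳ (sum torsion) ⟩
    sum torsion                       ∎
    where open ≡.≡-Reasoning

  length-elements : length elements ≡ length torsion + length nonTorsion
  length-elements = ≡.trans (≡.sym (↭.↭-length torsion++nonTorsion↭elements)) (List.length-++ torsion)

  OrderTwo : X → Set
  OrderTwo x = x ≢ ε × TwoTorsion x

  TwoInvolutions : Set
  TwoInvolutions = Σ X λ x → Σ X λ y → OrderTwo x × OrderTwo y × x ≢ y

  sum≡ε∧even⇒twoInvolutions : sum elements ≡ ε → 2 ∣ length elements → TwoInvolutions
  sum≡ε∧even⇒twoInvolutions sum≡ε (divides q even) =
    let rest , torsion↭ = ∈⇒↭∷ (∈-torsion⁺ (identityˡ ε)) in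
    cases rest torsion↭ (Unique-resp-↭ torsion↭ torsion-unique)
    where
      open ≡.≡-Reasoning
      p : ℕ
      p = length inversePairs

      cases : ∀ rest → torsion ↭ ε ∷ rest → Unique (ε ∷ rest) → TwoInvolutions
      cases [] torsion↭ _ = ⊥-elim (ℕ.even≢odd q p (begin
        2 * q                  ≡⟨ ℕ.*-comm 2 q ⟩
        q * 2                  ≡⟨ even ⟨
        length elements        ≡⟨ length-elements ⟩
        length torsion + length nonTorsion ≡⟨ ≡.cong₂ _+_ (↭.↭-length torsion↭) length-nonTorsion ⟩
        suc (p * 2)            ≡⟨ ≡.cong suc (ℕ.*-comm p 2) ⟩
        suc (2 * p)            ∎))
      cases (y ∷ []) torsion↭ ((ε≢y ∷ []) ∷ _) = ⊥-elim (ε≢y (≡.sym (begin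
        y                      ≡⟨ identityʳ y ⟨
        y ∙ ε                  ≡⟨ identityˡ (y ∙ ε) ⟨
        sum (ε ∷ y ∷ [])       ≡⟨ sum-↭ torsion↭ ⟨
        sum torsion            ≡⟨ sum-elements≡sum-torsion ⟨
        sum elements           ≡⟨ sum≡ε ⟩
        ε                      ∎)))
      cases (y ∷ z ∷ _) torsion↭ ((ε≢y ∷ ε≢z ∷ _) ∷ (y≢z ∷ _) ∷ _) =
        y , z , (ε≢y ∘ ≡.sym , ∈-torsion⁻ (∈torsion (there (here refl)))) ,
                (ε≢z ∘ ≡.sym , ∈-torsion⁻ (∈torsion (there (there (here refl))))) , y≢z
        where
          ∈torsion : ∀ {x} → x ∈ ε ∷ y ∷ z ∷ _ → x ∈ torsion
          ∈torsion = ↭.∈-resp-↭ (↭-sym torsion↭)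

  IsZeroSumPartition : ∀ {t k} → (Fin t → Fin k → X) → Set
  IsZeroSumPartition B =
    Injective₂ B × (∀ x → ∃₂ λ i j → B i j ≡ x) × (∀ i → ZeroSum (tabulate (B i)))

  HasZeroSumPartition : ℕ → Set
  HasZeroSumPartition k = ∃₂ λ t (B : Fin t → Fin k → X) → IsZeroSumPartition B

  zeroSumPartition⇒sum≡ε : ∀ {t k} {B : Fin t → Fin k → X} → IsZeroSumPartition B →
                           sum elements ≡ ε
  zeroSumPartition⇒sum≡ε {B = B} (injective , surjective , sums) =
    ≡.trans (sum-↭ (↭-sym flatten↭elements)) (ZeroSum-concat (All.tabulate⁺ sums))
    where
      flatten↭elements : flatten B ↭ elements
      flatten↭elements = unique∧⊆∧⊇⇒↭ (flatten-unique⁺ B injective) elements-unique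
        (λ {x} _ → ∈-elements x)
        (λ {x} _ → let i , j , Bij≡x = surjective x in
                   ≡.subst (_∈ flatten B) Bij≡x (∈-flatten⁺ B i j))

  f₀∙f₁≡ε : ∀ (f : Fin 2 → X) → ZeroSum (tabulate f) → f zero ∙ f (suc zero) ≡ ε
  f₀∙f₁≡ε f zeroSum = ≡.trans (≡.cong (f zero ∙_) (≡.sym (identityʳ _))) zeroSum

  ε-partner : ∀ {x y} → x ∙ y ≡ ε → x ≡ ε → y ≡ ε
  ε-partner {x} {y} x∙y≡ε x≡ε =
    ≡.trans (≡.sym (identityˡ y)) (≡.trans (≡.cong (_∙ y) (≡.sym x≡ε)) x∙y≡ε)

  zeroSumPair-ε⇒≡ : ∀ (f : Fin 2 → X) → ZeroSum (tabulate f) →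
                    ∀ j → f j ≡ ε → f zero ≡ f (suc zero)
  zeroSumPair-ε⇒≡ f zeroSum zero       f₀≡ε =
    ≡.trans f₀≡ε (≡.sym (ε-partner (f₀∙f₁≡ε f zeroSum) f₀≡ε))
  zeroSumPair-ε⇒≡ f zeroSum (suc zero) f₁≡ε =
    ≡.trans (ε-partner (≡.trans (comm _ _) (f₀∙f₁≡ε f zeroSum)) f₁≡ε) (≡.sym f₁≡ε)

  ¬zeroSumPartition₂ : ∀ {t} {B : Fin t → Fin 2 → X} → ¬ IsZeroSumPartition B
  ¬zeroSumPartition₂ {B = B} (injective , surjective , sums)
    with i , j , Bij≡ε ← surjective ε
    with () ← proj₂ (injective i zero i (suc zero) (zeroSumPair-ε⇒≡ (B i) (sums i) j Bij≡ε))

  zeroSumPartition⇒2≤m : ∀ m → 1 ≤ m → ∀ {t} {B : Fin t → Fin (2 * m) → X} →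
                         IsZeroSumPartition B → 2 ≤ m
  zeroSumPartition⇒2≤m (suc zero)    _ B-partition = ⊥-elim (¬zeroSumPartition₂ B-partition)
  zeroSumPartition⇒2≤m (suc (suc m)) _ _           = s≤s (s≤s z≤n)

  partition⇒zeroSumPartition : ∀ {k} → Partition k elements → HasZeroSumPartition k
  partition⇒zeroSumPartition {k} partition =
    length blocks , B , flatten-unique⁻ B (Unique-resp-↭ (↭-sym flatten↭elements) elements-unique) ,
    (λ x → ∈-flatten⁻ B (↭.∈-resp-↭ (↭-sym flatten↭elements) (∈-elements x))) ,
    All.tabulate⁻ (≡.subst (All ZeroSum) (≡.sym (tabulate-fromBlocks blocks lengths))
                          (All.map proj₂ blocks-pieces))
    where
      open Partition partition
      lengths : All (λ b → length b ≡ k) blocks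
      lengths = All.map proj₁ blocks-pieces
      B : Fin (length blocks) → Fin k → X
      B = fromBlocks blocks lengths
      flatten↭elements : flatten B ↭ elements
      flatten↭elements = ≡.subst (_↭ elements)
        (≡.sym (≡.cong concat (tabulate-fromBlocks blocks lengths))) blocks-↭

  Closed∙ : List X → Set
  Closed∙ H = ∀ {x y} → x ∈ H → y ∈ H → x ∙ y ∈ H

  ∙-cancel-TwoTorsion : ∀ x {y} → TwoTorsion y → (x ∙ y) ∙ y ≡ x
  ∙-cancel-TwoTorsion x {y} yy = ≡.trans (assoc x y y) (≡.trans (≡.cong (x ∙_) yy) (identityʳ x))

  TwoTorsion⇒∙-involutive : ∀ {a} → TwoTorsion a → ∀ x → a ∙ (a ∙ x) ≡ x
  TwoTorsion⇒∙-involutive {a} aa x =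
    ≡.trans (≡.sym (assoc a a x)) (≡.trans (≡.cong (_∙ x) aa) (identityˡ x))

  module _ {S} (S-unique : Unique S) (S-closed : Closed∙ S)
           (S-torsion : ∀ {x} → x ∈ S → TwoTorsion x) where

    adjoin : ∀ {H c} → Unique H → H ⊆ S → Closed∙ H → c ∈ S → c ∉ H →
             Unique (H ++ map (c ∙_) H) × H ++ map (c ∙_) H ⊆ S × Closed∙ (H ++ map (c ∙_) H)
    adjoin {H} {c} H-unique H⊆S H-closed c∈S c∉H =
      Unique.++⁺ H-unique (Unique.map⁺ (∙-cancelˡ c _ _) H-unique) disjoint , H′⊆S , H′-closed
      where
        c∙H : ∀ {x} → x ∈ map (c ∙_) H → ∃ λ y → y ∈ H × x ≡ c ∙ y
        c∙H = ∈-map⁻ (c ∙_)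

        disjoint : ∀ {x} → ¬ (x ∈ H × x ∈ map (c ∙_) H)
        disjoint (x∈H , x∈cH) with y , y∈H , refl ← c∙H x∈cH =
          c∉H (≡.subst (_∈ H) (∙-cancel-TwoTorsion c (S-torsion (H⊆S y∈H))) (H-closed x∈H y∈H))

        H′⊆S : H ++ map (c ∙_) H ⊆ S
        H′⊆S x∈ with ∈-++⁻ H x∈
        ... | inj₁ x∈H = H⊆S x∈H
        ... | inj₂ x∈cH with y , y∈H , refl ← c∙H x∈cH = S-closed c∈S (H⊆S y∈H)

        H′-closed : Closed∙ (H ++ map (c ∙_) H)
        H′-closed {x} {y} x∈ y∈ with ∈-++⁻ H x∈ | ∈-++⁻ H y∈
        ... | inj₁ x∈H | inj₁ y∈H = ∈-++⁺ˡ (H-closed x∈H y∈H)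
        ... | inj₁ x∈H | inj₂ y∈cH with y′ , y′∈H , refl ← c∙H y∈cH =
          ∈-++⁺ʳ H (≡.subst (_∈ map (c ∙_) H) (≡.sym (x∙yz≈y∙xz x c y′))
                             (∈-map⁺ (c ∙_) (H-closed x∈H y′∈H)))
        ... | inj₂ x∈cH | inj₁ y∈H with x′ , x′∈H , refl ← c∙H x∈cH =
          ∈-++⁺ʳ H (≡.subst (_∈ map (c ∙_) H) (≡.sym (assoc c x′ y))
                             (∈-map⁺ (c ∙_) (H-closed x′∈H y∈H)))
        ... | inj₂ x∈cH | inj₂ y∈cH
          with x′ , x′∈H , refl ← c∙H x∈cH | y′ , y′∈H , refl ← c∙H y∈cH =
          ∈-++⁺ˡ (≡.subst (_∈ H) (≡.sym (≡.trans (interchange c x′ c y′)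
                                    (≡.trans (≡.cong (_∙ (x′ ∙ y′)) (S-torsion c∈S)) (identityˡ _))))
                                  (H-closed x′∈H y′∈H))

    length-power-of-two : ε ∈ S → ∃ λ j → length S ≡ 2 ^ j
    length-power-of-two ε∈S = grow (length S) 0 (ℕ.m≤m+n (length S) 1) ([] ∷ [])
      (λ { (here refl) → ε∈S }) (λ { (here refl) (here refl) → here (identityˡ ε) }) refl
      where
        grow : ∀ f j {H} → length S ≤ f + length H → Unique H → H ⊆ S → Closed∙ H →
               length H ≡ 2 ^ j → ∃ λ j → length S ≡ 2 ^ j
        grow f j {H} bound H-unique H⊆S H-closed H-length with all? (_∈? H) S
        ... | yes S⊆H = j , ≡.trans (ℕ.≤-antisym (unique∧⊆⇒length≤ S-unique (All.lookup S⊆H))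
                                                 (unique∧⊆⇒length≤ H-unique H⊆S)) H-length
        ... | no S⊈H with c , c∈S , c∉H ← find (¬All⇒Any¬ (_∈? H) S S⊈H)
                     with H′-unique , H′⊆S , H′-closed ← adjoin H-unique H⊆S H-closed c∈S c∉H
                     = continue f bound
          where
            L : ℕ
            L = length H
            1≤L : 1 ≤ L
            1≤L = ≡.subst (1 ≤_) (≡.sym H-length) (ℕ.m^n>0 2 j)
            H′-length : length (H ++ map (c ∙_) H) ≡ L + L
            H′-length = ≡.trans (List.length-++ H) (≡.cong (L +_) (List.length-map (c ∙_) H))
            L+L≤S : L + L ≤ length S
            L+L≤S = ≡.subst (_≤ length S) H′-length (unique∧⊆⇒length≤ H′-unique H′⊆S)
            continue : ∀ f → length S ≤ f + L → ∃ λ j → length S ≡ 2 ^ j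
            continue zero    bound = ⊥-elim (ℕ.<-irrefl refl
              (ℕ.≤-trans (ℕ.m<m+n L 1≤L) (ℕ.≤-trans L+L≤S bound)))
            continue (suc f) bound = grow f (suc j) {H ++ map (c ∙_) H}
              (ℕ.≤-trans bound (≡.subst₂ (λ a b → a ≤ f + b) (ℕ.+-suc f L) (≡.sym H′-length)
                (ℕ.+-monoʳ-≤ f (≡.subst (_≤ L + L) (ℕ.+-comm L 1) (ℕ.+-monoʳ-≤ L 1≤L)))))
              H′-unique H′⊆S H′-closed
              (≡.trans H′-length
                (≡.cong₂ _+_ H-length (≡.trans H-length (≡.sym (ℕ.+-identityʳ _)))))

  length-torsion-power-of-two : ∃ λ j → length torsion ≡ 2 ^ j
  length-torsion-power-of-two = length-power-of-two torsion-unique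
    (λ x∈ y∈ → ∈-torsion⁺ (TwoTorsion-∙ (∈-torsion⁻ x∈) (∈-torsion⁻ y∈)))
    ∈-torsion⁻ (∈-torsion⁺ (identityˡ ε))

  length-torsion≤length-nonTorsion : ∀ {x} → x ∈ nonTorsion → length torsion ≤ length nonTorsion
  length-torsion≤length-nonTorsion {x} x∈ =
    ≡.subst (_≤ length nonTorsion) (List.length-map (x ∙_) torsion)
      (unique∧⊆⇒length≤ (Unique.map⁺ (∙-cancelˡ x _ _) torsion-unique) x∙torsion⊆nonTorsion)
    where
      x∙torsion⊆nonTorsion : map (x ∙_) torsion ⊆ nonTorsion
      x∙torsion⊆nonTorsion y∈ with y , y∈T , refl ← ∈-map⁻ (x ∙_) y∈ =
        ∈-nonTorsion⁺ λ xy-torsion → ∈-nonTorsion⁻ x∈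
          (≡.subst TwoTorsion (∙-cancel-TwoTorsion x (∈-torsion⁻ y∈T))
                   (TwoTorsion-∙ xy-torsion (∈-torsion⁻ y∈T)))

  module _ {a b} (a-involution : OrderTwo a) (b-involution : OrderTwo b) (a≢b : a ≢ b) where

    private
      a≢ε : a ≢ ε
      a≢ε = proj₁ a-involution
      aa : TwoTorsion a
      aa = proj₂ a-involution

    4∣length-torsion : 4 ∣ length torsion
    4∣length-torsion with j , length≡2^j ← length-torsion-power-of-two
      = ≡.subst (4 ∣_) (≡.sym length≡2^j) (4∣2^ j (≡.subst (3 ≤_) length≡2^j 3≤length))
      where
        εab-unique : Unique (ε ∷ a ∷ b ∷ [])
        εab-unique = (a≢ε ∘ ≡.sym ∷ proj₁ b-involution ∘ ≡.sym ∷ []) ∷ (a≢b ∷ []) ∷ [] ∷ []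
        3≤length : 3 ≤ length torsion
        3≤length = unique∧⊆⇒length≤ εab-unique λ where
          (here refl)                 → ∈-torsion⁺ (identityˡ ε)
          (there (here refl))         → ∈-torsion⁺ aa
          (there (there (here refl))) → ∈-torsion⁺ (proj₂ b-involution)

    translationOrbits : ∃ λ zs → concat (map (orbit (a ∙_)) zs) ↭ torsion
    translationOrbits = ↭-concat-orbits (a ∙_) (TwoTorsion⇒∙-involutive aa) torsion-unique
      (λ x∈ → ∈-torsion⁺ (TwoTorsion-∙ aa (∈-torsion⁻ x∈)))
      (λ {x} _ a∙x≡x → a≢ε (∙-cancelʳ x a ε (≡.trans a∙x≡x (≡.sym (identityˡ x)))))

    torsionQuads : ∃ λ qs → Pieces 4 qs × concat qs ↭ torsion
    torsionQuads = proj₁ quads , proj₁ (proj₂ quads) ,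
                   ≡.subst (_↭ torsion) (≡.sym (proj₂ (proj₂ quads))) (proj₂ translationOrbits)
      where
        zs : List X
        zs = proj₁ translationOrbits
        pairs : List (List X)
        pairs = map (orbit (a ∙_)) zs
        q : ℕ
        q = quotient 4∣length-torsion

        SumsToA : List X → Set
        SumsToA u = length u ≡ 2 × sum u ≡ a

        pairs-ok : All SumsToA pairs
        pairs-ok = All.map⁺ (All.tabulate λ {z} z∈zs → refl , (begin
          z ∙ ((a ∙ z) ∙ ε) ≡⟨ ≡.cong (z ∙_) (identityʳ (a ∙ z)) ⟩
          z ∙ (a ∙ z)       ≡⟨ x∙yz≈y∙xz z a z ⟩
          a ∙ (z ∙ z)       ≡⟨ ≡.cong (a ∙_) (∈-torsion⁻ (z∈torsion z∈zs)) ⟩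
          a ∙ ε             ≡⟨ identityʳ a ⟩
          a                 ∎))
          where
            open ≡.≡-Reasoning
            z∈torsion : ∀ {z} → z ∈ zs → z ∈ torsion
            z∈torsion z∈zs = ↭.∈-resp-↭ (proj₂ translationOrbits)
              (∈-concat⁺′ (here refl) (∈-map⁺ (orbit (a ∙_)) z∈zs))

        join : ∀ {u v} → SumsToA u → SumsToA v → length (u ++ v) ≡ 4 × ZeroSum (u ++ v)
        join {u} {v} (|u|≡2 , Σu≡a) (|v|≡2 , Σv≡a) =
          ≡.trans (List.length-++ u) (≡.cong₂ _+_ |u|≡2 |v|≡2) ,
          ≡.trans (sum-++ u v) (≡.trans (≡.cong₂ _∙_ Σu≡a Σv≡a) aa)

        length-pairs : length pairs ≡ q * 2
        length-pairs = ℕ.*-cancelʳ-≡ (length pairs) (q * 2) 2 (begin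
          length pairs * 2                ≡⟨ ≡.cong (_* 2) (List.length-map (orbit (a ∙_)) zs) ⟩
          length zs * 2                   ≡⟨ length-concat-orbits (a ∙_) zs ⟨
          length (concat pairs)           ≡⟨ ↭.↭-length (proj₂ translationOrbits) ⟩
          length torsion                  ≡⟨ _∣_.equality 4∣length-torsion ⟩
          q * 4                           ≡⟨ ℕ.*-assoc q 2 2 ⟨
          q * 2 * 2                       ∎)
          where open ≡.≡-Reasoning

        quads : ∃ λ vs → Pieces 4 vs × concat vs ≡ concat pairs
        quads = pairUp {P = SumsToA} {Q = λ w → length w ≡ 4 × ZeroSum w}
                       (λ {u} {v} → join {u} {v}) q pairs length-pairs pairs-ok

  enough-inversePairs : ∀ t c → 1 ≤ c → length elements ≡ t * (2 * (1 + c * 2)) →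
                        t ≤ length inversePairs
  enough-inversePairs t c 1≤c n≡ = cases nonTorsion ≡.refl
    where
      cases : ∀ xs → nonTorsion ≡ xs → t ≤ length inversePairs
      cases [] nonTorsion≡[] with j , length≡2^j ← length-torsion-power-of-two =
        ⊥-elim (2^≢*odd j t c 1≤c (begin
          2 ^ j                               ≡⟨ length≡2^j ⟨
          length torsion                      ≡⟨ ℕ.+-identityʳ _ ⟨
          length torsion + 0
            ≡⟨ ≡.cong (λ xs → length torsion + length xs) nonTorsion≡[] ⟨
          length torsion + length nonTorsion  ≡⟨ length-elements ⟨
          length elements                     ≡⟨ n≡ ⟩
          t * (2 * (1 + c * 2))               ∎))
        where open ≡.≡-Reasoning
      cases (x ∷ _) nonTorsion≡x∷ = ℕ.*-cancelʳ-≤ t p 6 (begin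
        t * 6
          ≤⟨ ℕ.*-monoʳ-≤ t (ℕ.*-monoʳ-≤ 2 (s≤s (ℕ.*-monoˡ-≤ 2 1≤c))) ⟩
        t * (2 * (1 + c * 2))                 ≡⟨ n≡ ⟨
        length elements                       ≡⟨ length-elements ⟩
        length torsion + length nonTorsion
          ≤⟨ ℕ.+-monoˡ-≤ (length nonTorsion) (length-torsion≤length-nonTorsion x∈) ⟩
        length nonTorsion + length nonTorsion ≡⟨ ≡.cong₂ _+_ length-nonTorsion length-nonTorsion ⟩
        p * 2 + p * 2                         ≡⟨ lemma p ⟩
        p * 4                                 ≤⟨ ℕ.*-monoʳ-≤ p (ℕ.m≤m+n 4 2) ⟩
        p * 6                                 ∎)
        where
          open ℕ.≤-Reasoning
          p : ℕ
          p = length inversePairs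
          x∈ : x ∈ nonTorsion
          x∈ = ≡.subst (x ∈_) (≡.sym nonTorsion≡x∷) (here refl)
          lemma : ∀ p → p * 2 + p * 2 ≡ p * 4
          lemma = solve-∀

  twoInvolutions⇒zeroSumPartition : TwoInvolutions → ∀ m → 2 ≤ m → 2 * m ∣ length elements →
                                    HasZeroSumPartition (2 * m)
  twoInvolutions⇒zeroSumPartition (_ , _ , a-involution , b-involution , a≢b) m 2≤m
                                  (divides t n≡t*2m) =
    ≡.subst HasZeroSumPartition (≡.cong (2 *_) (≡.sym m≡r+c*2))
      (partition⇒zeroSumPartition (Partition-resp-↭ pieces↭elements
        (pack c r 1≤c r≤1 t qs inversePairs qs-ok inversePairs-ok total odd)))
    where
      qs : List (List X)
      qs = proj₁ (torsionQuads a-involution b-involution a≢b)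
      qs-ok : Pieces 4 qs
      qs-ok = proj₁ (proj₂ (torsionQuads a-involution b-involution a≢b))
      qs↭torsion : concat qs ↭ torsion
      qs↭torsion = proj₂ (proj₂ (torsionQuads a-involution b-involution a≢b))

      pieces↭elements : concat qs ++ concat inversePairs ↭ elements
      pieces↭elements =
        ↭-trans (↭.++⁺ qs↭torsion (proj₂ inverseOrbits)) torsion++nonTorsion↭elements

      r c : ℕ
      r = m % 2
      c = m / 2
      m≡r+c*2 : m ≡ r + c * 2
      m≡r+c*2 = m≡m%n+[m/n]*n m 2
      1≤c : 1 ≤ c
      1≤c = m≥n⇒m/n>0 2≤m
      r≤1 : r ≤ 1
      r≤1 = ℕ.≤-pred (m%n<n m 2)

      total : length qs * 4 + length inversePairs * 2 ≡ t * (2 * (r + c * 2))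
      total = begin
        length qs * 4 + length inversePairs * 2
          ≡⟨ ≡.cong₂ _+_ (proj₁ (concat-pieces qs qs-ok)) length-nonTorsion ⟨
        length (concat qs) + length nonTorsion
          ≡⟨ ≡.cong (_+ length nonTorsion) (↭.↭-length qs↭torsion) ⟩
        length torsion + length nonTorsion      ≡⟨ length-elements ⟨
        length elements                         ≡⟨ n≡t*2m ⟩
        t * (2 * m)                             ≡⟨ ≡.cong (λ m → t * (2 * m)) m≡r+c*2 ⟩
        t * (2 * (r + c * 2))                   ∎
        where open ≡.≡-Reasoning

      odd : r ≡ 1 → t ≤ length inversePairs
      odd r≡1 = enough-inversePairs t c 1≤c (≡.trans n≡t*2m
        (≡.cong (λ m → t * (2 * m)) (≡.trans m≡r+c*2 (≡.cong (_+ c * 2) r≡1))))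

-- The group is transported to Fin n, where equality is propositional and decidable, so
-- that its elements form a duplicate-free list.
module Transfer {c ℓ} (G : AbelianGroup c ℓ) {n} (bijection : HasOrder G n) where

  open AbelianGroup G using (Carrier; _≈_; _∙_; ε; _⁻¹; ∙-cong; monoid; rawGroup; isAbelianGroup)
    renaming (refl to ≈-refl; sym to ≈-sym; trans to ≈-trans)
  open Bijection bijection using (to; injective; surjection) renaming (cong to to-cong)
  open Surjection surjection using (to⁻; to∘to⁻)
  private module ∑ = MonoidSum monoid

  _⊕_ : Op₂ (Fin n)
  i ⊕ j = to⁻ (to i ∙ to j)

  o : Fin n
  o = to⁻ ε

  ⊖_ : Op₁ (Fin n)
  ⊖ i = to⁻ (to i ⁻¹)

  finRawGroup : RawGroup 0ℓ 0ℓ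
  finRawGroup = record { Carrier = Fin n ; _≈_ = _≡_ ; _∙_ = _⊕_ ; ε = o ; _⁻¹ = ⊖_ }

  to-isGroupMonomorphism : IsGroupMonomorphism finRawGroup rawGroup to
  to-isGroupMonomorphism = record
    { isGroupHomomorphism = record
      { isMonoidHomomorphism = record
        { isMagmaHomomorphism = record
          { isRelHomomorphism = record { cong = to-cong }
          ; homo = λ i j → to∘to⁻ (to i ∙ to j)
          }
        ; ε-homo = to∘to⁻ ε
        }
      ; ⁻¹-homo = λ i → to∘to⁻ (to i ⁻¹)
      }
    ; injective = injective
    }

  open FiniteAbelianGroup Fin._≟_
    (GroupMonomorphism.isAbelianGroup to-isGroupMonomorphism isAbelianGroup)
    (allFin n) (Unique.allFin⁺ n) ∈-allFin public

  to-sum : ∀ {k} (f : Fin k → Fin n) → to (sum (tabulate f)) ≈ ∑.sum (to ∘ f)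
  to-sum {zero}  f = to∘to⁻ ε
  to-sum {suc k} f = ≈-trans (to∘to⁻ _) (∙-cong ≈-refl (to-sum (f ∘ suc)))

  to-injective-ε : ∀ {i} → to i ≈ ε → i ≡ o
  to-injective-ε to-i≈ε = injective (≈-trans to-i≈ε (≈-sym (to∘to⁻ ε)))

  ZSP⇒zeroSumPartition : ∀ {k} → ZSP G n k →
    k ∣ n × 2 ≤ k × HasZeroSumPartition k
  ZSP⇒zeroSumPartition (k∣n , 2≤k , t , A , A-injective , A-surjective , A-sums) =
    k∣n , 2≤k , t , (λ i j → to⁻ (A i j)) ,
    (λ i j i′ j′ e → A-injective i j i′ j′
      (≈-trans (≈-sym (to∘to⁻ _)) (≈-trans (to-cong e) (to∘to⁻ _)))) ,
    (λ x → let i , j , Aij≈ = A-surjective (to x) in i , j , injective (≈-trans (to∘to⁻ _) Aij≈)) ,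
    (λ i → to-injective-ε (≈-trans (to-sum (to⁻ ∘ A i))
                                   (≈-trans (∑.sum-cong-≋ (to∘to⁻ ∘ A i)) (A-sums i))))

  zeroSumPartition⇒ZSP : ∀ {k} → k ∣ n → 2 ≤ k →
    HasZeroSumPartition k → ZSP G n k
  zeroSumPartition⇒ZSP k∣n 2≤k (t , B , B-injective , B-surjective , B-sums) =
    k∣n , 2≤k , t , (λ i j → to (B i j)) ,
    (λ i j i′ j′ e → B-injective i j i′ j′ (injective e)) ,
    (λ g → let i , j , Bij≡ = B-surjective (to⁻ g) in i , j , ≈-trans (to-cong Bij≡) (to∘to⁻ g)) ,
    (λ i → ≈-trans (≈-sym (to-sum (B i))) (≈-trans (to-cong (B-sums i)) (to∘to⁻ ε)))

  to-orderTwo : ∀ {i} → OrderTwo i → IsInvolution G (to i)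
  to-orderTwo {i} (i≢o , ii) =
    (λ to-i≈ε → i≢o (to-injective-ε to-i≈ε)) ,
    ≈-trans (≈-sym (to∘to⁻ (to i ∙ to i))) (≈-trans (to-cong ii) (to∘to⁻ ε))

  from-involution : ∀ {g} → IsInvolution G g → OrderTwo (to⁻ g)
  from-involution {g} (g≉ε , gg) =
    (λ e → g≉ε (≈-trans (≈-sym (to∘to⁻ g)) (≈-trans (to-cong e) (to∘to⁻ ε)))) ,
    to-injective-ε (≈-trans (to∘to⁻ _) (≈-trans (∙-cong (to∘to⁻ g) (to∘to⁻ g)) gg))

  twoInvolutions⇒MoreThanOneInvolution : TwoInvolutions → MoreThanOneInvolution G
  twoInvolutions⇒MoreThanOneInvolution (i , j , i-order , j-order , i≢j) =
    to i , to j , to-orderTwo i-order , to-orderTwo j-order , i≢j ∘ injective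

  moreThanOneInvolution⇒TwoInvolutions : MoreThanOneInvolution G → TwoInvolutions
  moreThanOneInvolution⇒TwoInvolutions (g , h , g-inv , h-inv , g≉h) =
    to⁻ g , to⁻ h , from-involution g-inv , from-involution h-inv ,
    λ e → g≉h (≈-trans (≈-sym (to∘to⁻ g)) (≈-trans (to-cong e) (to∘to⁻ h)))

  length-elements≡n : length (allFin n) ≡ n
  length-elements≡n = List.length-tabulate (λ i → i)

mainTheorem3 : ∀ {c ℓ : Level} (G : AbelianGroup c ℓ) (n m : ℕ) →
    HasOrder G n → 1 ≤ m →
    ZSP G n (2 * m) ⇔ (2 * m ∣ n × 2 ≤ m × (¬ (2 ∣ n) ⊎ MoreThanOneInvolution G))
mainTheorem3 G n m bijection 1≤m = mk⇔ necessary sufficient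
  where
    open Transfer G bijection

    necessary : ZSP G n (2 * m) → 2 * m ∣ n × 2 ≤ m × (¬ (2 ∣ n) ⊎ MoreThanOneInvolution G)
    necessary zsp with 2m∣n , _ , _ , _ , partition ← ZSP⇒zeroSumPartition zsp =
      2m∣n , zeroSumPartition⇒2≤m m 1≤m partition ,
      inj₂ (twoInvolutions⇒MoreThanOneInvolution (sum≡ε∧even⇒twoInvolutions
        (zeroSumPartition⇒sum≡ε partition)
        (≡.subst (2 ∣_) (≡.sym length-elements≡n) (∣-trans (m∣m*n m) 2m∣n))))

    sufficient : 2 * m ∣ n × 2 ≤ m × (¬ (2 ∣ n) ⊎ MoreThanOneInvolution G) → ZSP G n (2 * m)
    sufficient (2m∣n , _   , inj₁ n-odd) = ⊥-elim (n-odd (∣-trans (m∣m*n m) 2m∣n))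
    sufficient (2m∣n , 2≤m , inj₂ involutions) = zeroSumPartition⇒ZSP 2m∣n
      (ℕ.≤-trans 2≤m (ℕ.m≤n*m m 2))
      (twoInvolutions⇒zeroSumPartition (moreThanOneInvolution⇒TwoInvolutions involutions) m 2≤m
        (≡.subst (2 * m ∣_) (≡.sym length-elements≡n) 2m∣n))
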